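{- If an Elena of size $n$ is chosen uniformly at random, its expected height (the maximal distance from the root to a node) is asymptotic to $\frac{5-\sqrt5}{10}\,n$ as $n\to\infty$.
   Context: Planted plane trees are rooted trees in which the children of every node are linearly ordered. An Elena is a planted plane tree of the following form: there are nodes $v_1,\dots,v_k$ ($k\ge 1$), with $v_1$ the root, such that for each $i<k$ the node $v_{i+1}$ is the rightmost child of $v_i$, the node $v_k$ is a leaf, and for each $i<k$ every other child of $v_i$ (any number $\ge0$ of them, placed to the left of $v_{i+1}$) is the top node of a path (a chain of $\ge1$ nodes each having at most one child). Equivalently, Elenas correspond to words of the language $(\mathtt{a}\,\mathtt{p}^*)^*\mathtt{a}$, with $\mathtt{a}$ a rightmost-branch node and $\mathtt{p}$ an attached path. Under the standard bijection with Dyck paths, Elenas of size $n$ correspond to nondecreasing Dyck paths (valley altitudes nondecreasing) of length $2(n-1)$. The size of an Elena is its number of nodes. -}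

module Defs where

open import Data.Nat as ℕ using (ℕ; zero; suc; _⊔_; _≥_)
open import Data.Bool using (Bool; true; false; _∧_; T)
open import Data.List using (List; []; _∷_; length; map)
open import Data.Nat.ListAction using (sum)
open import Data.List.Membership.Propositional using (_∈_)
open import Data.List.Relation.Unary.Unique.Propositional using (Unique)
open import Data.Integer using (+_)
open import Data.Rational using (ℚ; _/_; _<_; _*_; _-_; _+_)
open import Data.Product using (_×_; ∃-syntax)
open import Data.Sum using (_⊎_)
open import Function.Bundles using (_⇔_)
open import Relation.Binary.PropositionalEquality using (_≡_)

-- Planted plane trees: a node with an ordered list of children.
data Tree : Set where
  node : List Tree → Tree

mutual
  size : Tree → ℕ
  size (node ts) = suc (sizeF ts)

  sizeF : List Tree → ℕ
  sizeF [] = 0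
  sizeF (t ∷ ts) = size t ℕ.+ sizeF ts

mutual
  height : Tree → ℕ
  height (node ts) = heightF ts

  heightF : List Tree → ℕ
  heightF [] = 0
  heightF (t ∷ ts) = suc (height t) ⊔ heightF ts

isPath : Tree → Bool
isPath (node []) = true
isPath (node (t ∷ [])) = isPath t
isPath (node (_ ∷ _ ∷ _)) = false

mutual
  -- Elena: the rightmost child continues the spine (v_{i+1}), the last
  -- spine node v_k is a leaf, every other child is the top of a path.
  isElena : Tree → Bool
  isElena (node ts) = elenaKids ts

  elenaKids : List Tree → Bool
  elenaKids [] = true
  elenaKids (t ∷ []) = isElena t
  elenaKids (t ∷ ts@(_ ∷ _)) = isPath t ∧ elenaKids ts

IsElena : Tree → Set
IsElena t = T (isElena t)

EnumeratesElenas : ℕ → List Tree → Set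
EnumeratesElenas n L =
  Unique L × (∀ (t : Tree) → (t ∈ L) ⇔ (IsElena t × size t ≡ n))

toℚ : ℕ → ℚ
toℚ n = + n / 1

-- Comparisons of a rational q with the irrational c = (5 - √5)/10,
-- written without reals:  q < c  ⇔  √5 < 5 - 10q
--                          c < q  ⇔  5 - 10q < √5
LtC : ℚ → Set
LtC q = (toℚ 0 < toℚ 5 - toℚ 10 * q) × (toℚ 5 < (toℚ 5 - toℚ 10 * q) * (toℚ 5 - toℚ 10 * q))

CLt : ℚ → Set
CLt q = (toℚ 5 - toℚ 10 * q < toℚ 0) ⊎ ((toℚ 5 - toℚ 10 * q) * (toℚ 5 - toℚ 10 * q) < toℚ 5)

-- Given enumerations L n of the Elenas of size n, the expected height is
-- E n = sum (map height (L n)) / length (L n).  "E n / n → c" is stated as: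
-- for all rationals a < c < b, eventually a·(#Elenas·n) < total height < b·(#Elenas·n).
ExpectedHeightRatioTendsToC : (ℕ → List Tree) → Set
ExpectedHeightRatioTendsToC L =
  ∀ (a b : ℚ) → LtC a → CLt b →
    ∃[ N ] ∀ (n : ℕ) → n ≥ N →
      (a * toℚ (length (L n) ℕ.* n) < toℚ (sum (map height (L n))))
      × (toℚ (sum (map height (L n))) < b * toℚ (length (L n) ℕ.* n))

module Submission where

-- Elenas, spine lists (children lists of spine nodes) and
--   path lists (spine lists starting with an attached path) are listed by
--   an explicit mutual recursion on the size; the lists are sound,
--   complete and duplicate-free, so any enumeration is a permutation.
-- * Height sandwich.  spine ≤ height ≤ spine + T + (T-excess), where the
--   T-excess sums how far attached paths go beyond depth T.  The total
--   (T+1)-excess is at most n·#Elenas / 2^T, because lengthening paths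
--   doubles the number of path lists at each step.
-- * Invariants.  Counts e, u and the spine total d satisfy linear
--   recurrences whose solutions obey e² + ue = u² + 1 (so x = 2u - e has
--   x² + 4 = 5e², i.e. x ≈ √5 e) and 5d + 3e + nu = 3ne + 4u.
-- * Rational estimates.  These identities give a·e·n < d for a < c and,
--   for b > c, d + T·e + excess < b·e·n once T and then n are large; the
--   irrational c only enters through squared comparisons with √5.

open import Defs

module Enumeration where

  open import Data.Nat using (ℕ; zero; suc; _+_)
  open import Data.Nat.Properties using (+-identityʳ)
  open import Data.Bool using (T)
  open import Data.Bool.Properties using (T-∧)
  open import Data.Unit using (tt)
  open import Data.List using (List; []; _∷_; map; _++_; [_])
  open import Data.List.Membership.Propositional using (_∈_)
  open import Data.List.Membership.Propositional.Properties
    using (∈-map⁺; ∈-map⁻; ∈-++⁺ˡ; ∈-++⁺ʳ)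
  open import Data.List.Membership.Propositional.Properties.WithK using (unique∧set⇒bag)
  open import Data.List.Relation.Unary.Any using (here)
  open import Data.List.Relation.Unary.Unique.Propositional using (Unique)
  import Data.List.Relation.Unary.Unique.Propositional.Properties as Unique
  open import Data.List.Relation.Unary.All using (All; []; _∷_)
  import Data.List.Relation.Unary.All as All
  import Data.List.Relation.Unary.AllPairs as AllPairs
  import Data.List.Relation.Unary.All.Properties as All
  open import Data.List.Relation.Binary.BagAndSetEquality using (∼bag⇒↭)
  open import Data.List.Relation.Binary.Permutation.Propositional using (_↭_)
  open import Data.Product using (_×_; _,_)
  open import Function.Bundles using (_⇔_; mk⇔; Equivalence)
  open import Relation.Nullary using (¬_)
  open import Relation.Binary.PropositionalEquality using (_≡_; refl; sym; trans; cong; subst)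

  leaf : Tree
  leaf = node []

  lengthenPath : List Tree → List Tree
  lengthenPath []      = []
  lengthenPath (p ∷ r) = node (p ∷ []) ∷ r

  -- Children lists of spine nodes.
  data SpineList : List Tree → Set where
    spineList : ∀ {q r} → T (elenaKids (q ∷ r)) → SpineList (q ∷ r)

  data PathList : List Tree → Set where
    pathList : ∀ {p q r} → T (isPath p) → T (elenaKids (q ∷ r)) → PathList (p ∷ q ∷ r)

  mutual
    elenas : ℕ → List Tree
    elenas zero          = []
    elenas (suc zero)    = leaf ∷ []
    elenas (suc (suc n)) = map node (spineLists (suc n))

    spineLists : ℕ → List (List Tree)
    spineLists n = map [_] (elenas n) ++ pathLists n

    pathLists : ℕ → List (List Tree)
    pathLists zero    = []
    pathLists (suc n) = map (leaf ∷_) (spineLists n) ++ map lengthenPath (pathLists n)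

  size-lengthenPath : ∀ p r → sizeF (lengthenPath (p ∷ r)) ≡ suc (sizeF (p ∷ r))
  size-lengthenPath p r = cong (λ s → suc (s + sizeF r)) (+-identityʳ (size p))

  mutual
    elenas-sound : ∀ n → All (λ t → IsElena t × size t ≡ n) (elenas n)
    elenas-sound zero          = []
    elenas-sound (suc zero)    = (tt , refl) ∷ []
    elenas-sound (suc (suc n)) =
      All.map⁺ (All.map (λ { (spineList el , sz) → el , cong suc sz }) (spineLists-sound (suc n)))

    spineLists-sound : ∀ n → All (λ ws → SpineList ws × sizeF ws ≡ n) (spineLists n)
    spineLists-sound n = All.++⁺
      (All.map⁺ (All.map (λ { {e} (el , sz) → spineList el , trans (+-identityʳ (size e)) sz }) (elenas-sound n)))
      (All.map (λ { (pathList pa el , sz) → spineList (Equivalence.from T-∧ (pa , el)) , sz }) (pathLists-sound n))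

    pathLists-sound : ∀ n → All (λ ws → PathList ws × sizeF ws ≡ n) (pathLists n)
    pathLists-sound zero    = []
    pathLists-sound (suc n) = All.++⁺
      (All.map⁺ (All.map (λ { (spineList el , sz) → pathList tt el , cong suc sz }) (spineLists-sound n)))
      (All.map⁺ (All.map (λ { (pathList {p} {q} {r} pa el , sz) →
                                pathList pa el , trans (size-lengthenPath p (q ∷ r)) (cong suc sz) })
                         (pathLists-sound n)))

  mutual
    elenas-complete : ∀ t → IsElena t → t ∈ elenas (size t)
    elenas-complete (node [])             _  = here refl
    elenas-complete (node (node qs ∷ r)) el = ∈-map⁺ node (spineLists-complete (node qs) r el)

    spineLists-complete : ∀ q r → T (elenaKids (q ∷ r)) → (q ∷ r) ∈ spineLists (sizeF (q ∷ r))
    spineLists-complete q [] el =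
      subst (λ k → (q ∷ []) ∈ spineLists k) (sym (+-identityʳ (size q)))
        (∈-++⁺ˡ (∈-map⁺ [_] (elenas-complete q el)))
    spineLists-complete q (q' ∷ r) el with Equivalence.to T-∧ el
    ... | pa , el' = ∈-++⁺ʳ (map [_] (elenas (sizeF (q ∷ q' ∷ r))))
                            (pathLists-complete q (q' ∷ r) pa (spineLists-complete q' r el'))

    pathLists-complete : ∀ p r {k} → T (isPath p) → r ∈ spineLists k → (p ∷ r) ∈ pathLists (size p + k)
    pathLists-complete (node [])          r pa r∈ = ∈-++⁺ˡ (∈-map⁺ (leaf ∷_) r∈)
    pathLists-complete (node (p ∷ []))    r {k} pa r∈ =
      subst (λ m → (node (p ∷ []) ∷ r) ∈ pathLists m) (sym (cong (_+ k) (cong suc (+-identityʳ (size p)))))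
        (∈-++⁺ʳ (map (leaf ∷_) (spineLists (size p + k)))
                (∈-map⁺ lengthenPath (pathLists-complete p r pa r∈)))
    pathLists-complete (node (_ ∷ _ ∷ _)) r () r∈

  -- The constructors used in the enumeration are injective, and the unions
  -- are disjoint, so no tree is listed twice.
  private
    node-injective : ∀ {xs ys} → node xs ≡ node ys → xs ≡ ys
    node-injective refl = refl

    [-]-injective : ∀ {x y : Tree} → [ x ] ≡ [ y ] → x ≡ y
    [-]-injective refl = refl

    leaf∷-injective : ∀ {xs ys : List Tree} → leaf ∷ xs ≡ leaf ∷ ys → xs ≡ ys
    leaf∷-injective refl = refl

    lengthenPath-injective : ∀ {xs ys} → lengthenPath xs ≡ lengthenPath ys → xs ≡ ys
    lengthenPath-injective {[]}    {[]}    eq   = refl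
    lengthenPath-injective {_ ∷ _} {_ ∷ _} refl = refl

  mutual
    elenas-unique : ∀ n → Unique (elenas n)
    elenas-unique zero          = AllPairs.[]
    elenas-unique (suc zero)    = [] AllPairs.∷ AllPairs.[]
    elenas-unique (suc (suc n)) = Unique.map⁺ node-injective (spineLists-unique (suc n))

    spineLists-unique : ∀ n → Unique (spineLists n)
    spineLists-unique n =
      Unique.++⁺ (Unique.map⁺ [-]-injective (elenas-unique n)) (pathLists-unique n) disjoint
      where
      -- a singleton is never a path list
      disjoint : ∀ {ws} → ¬ (ws ∈ map [_] (elenas n) × ws ∈ pathLists n)
      disjoint (ws∈ , ws∈') with ∈-map⁻ [_] ws∈ | All.lookup (pathLists-sound n) ws∈'
      ... | _ , _ , refl | () , _

    pathLists-unique : ∀ n → Unique (pathLists n)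
    pathLists-unique zero    = AllPairs.[]
    pathLists-unique (suc n) =
      Unique.++⁺ (Unique.map⁺ leaf∷-injective (spineLists-unique n))
                 (Unique.map⁺ lengthenPath-injective (pathLists-unique n)) disjoint
      where
      -- a lengthened path never consists of a single node
      disjoint : ∀ {ws} → ¬ (ws ∈ map (leaf ∷_) (spineLists n) × ws ∈ map lengthenPath (pathLists n))
      disjoint (ws∈ , ws∈') with ∈-map⁻ (leaf ∷_) ws∈ | ∈-map⁻ lengthenPath ws∈'
      ... | _ , _ , refl | []    , _ , ()
      ... | _ , _ , refl | _ ∷ _ , _ , ()

  elenas-membership : ∀ n t → (t ∈ elenas n) ⇔ (IsElena t × size t ≡ n)
  elenas-membership n t = mk⇔ (All.lookup (elenas-sound n)) (λ { (el , refl) → elenas-complete t el })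

  -- Any duplicate-free enumeration of the Elenas of size n is a permutation
  -- of the explicit one, so counts and totals may be computed on the latter.
  enumeration↭elenas : ∀ n L → EnumeratesElenas n L → L ↭ elenas n
  enumeration↭elenas n L (unique , membership) =
    ∼bag⇒↭ (unique∧set⇒bag unique (elenas-unique n) λ {t} →
      mk⇔ (λ t∈ → Equivalence.from (elenas-membership n t) (Equivalence.to (membership t) t∈))
          (λ t∈ → Equivalence.from (membership t) (Equivalence.to (elenas-membership n t) t∈)))


module HeightStatistics where

  open Enumeration
  open import Data.Nat using (ℕ; zero; suc; _+_; _*_; _∸_; _≤_; _^_; z≤n; s≤s)
  open import Data.Nat.Properties
  open import Data.Nat.ListAction using (sum)
  open import Data.Nat.ListAction.Properties using (sum-++)
  open import Data.Nat.Tactic.RingSolver using (solve-∀)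
  open import Data.List using (List; []; _∷_; map; _++_; [_]; length)
  open import Data.List.Properties using (map-++; map-∘)
  open import Data.List.Relation.Unary.All using (All; []; _∷_)
  import Data.List.Relation.Unary.All as All
  open import Data.Product using (_×_; _,_; proj₁; proj₂)
  open import Function using (_∘_)
  open import Relation.Binary.PropositionalEquality using (_≡_; refl; sym; trans; cong; cong₂)
  open ≤-Reasoning

  total : ∀ {A : Set} → (A → ℕ) → List A → ℕ
  total f xs = sum (map f xs)

  module _ {A : Set} where

    total-++ : ∀ (f : A → ℕ) xs ys → total f (xs ++ ys) ≡ total f xs + total f ys
    total-++ f xs ys = trans (cong sum (map-++ f xs ys)) (sum-++ (map f xs) (map f ys))

    total-map : ∀ {B : Set} (f : B → ℕ) (g : A → B) xs → total f (map g xs) ≡ total (f ∘ g) xs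
    total-map f g xs = cong sum (sym (map-∘ xs))

    total-cong : ∀ {f g : A → ℕ} {xs} → All (λ x → f x ≡ g x) xs → total f xs ≡ total g xs
    total-cong []           = refl
    total-cong (eq ∷ eqs)   = cong₂ _+_ eq (total-cong eqs)

    total-mono : ∀ {f g : A → ℕ} → (∀ x → f x ≤ g x) → ∀ xs → total f xs ≤ total g xs
    total-mono f≤g []       = z≤n
    total-mono f≤g (x ∷ xs) = +-mono-≤ (f≤g x) (total-mono f≤g xs)

    total-+ : ∀ (f g : A → ℕ) xs → total (λ x → f x + g x) xs ≡ total f xs + total g xs
    total-+ f g []       = refl
    total-+ f g (x ∷ xs) rewrite total-+ f g xs = interchange (f x) (g x) (total f xs) (total g xs)
      where
      interchange : ∀ a b c d → a + b + (c + d) ≡ a + c + (b + d)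
      interchange = solve-∀

    total-const : ∀ c (xs : List A) → total (λ _ → c) xs ≡ c * total (λ _ → 1) xs
    total-const c []       = sym (*-zeroʳ c)
    total-const c (x ∷ xs) = trans (cong (c +_) (total-const c xs)) (sym (*-suc c _))

  length≡total-1 : ∀ {A : Set} (xs : List A) → length xs ≡ total (λ _ → 1) xs
  length≡total-1 []       = refl
  length≡total-1 (_ ∷ xs) = cong suc (length≡total-1 xs)

  total-spineLists : ∀ (f : List Tree → ℕ) n →
    total f (spineLists n) ≡ total (f ∘ [_]) (elenas n) + total f (pathLists n)
  total-spineLists f n =
    trans (total-++ f (map [_] (elenas n)) (pathLists n)) (cong (_+ total f (pathLists n)) (total-map f [_] (elenas n)))

  total-pathLists : ∀ (f : List Tree → ℕ) n →
    total f (pathLists (suc n)) ≡ total (f ∘ (leaf ∷_)) (spineLists n) + total (f ∘ lengthenPath) (pathLists n)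
  total-pathLists f n =
    trans (total-++ f (map (leaf ∷_) (spineLists n)) (map lengthenPath (pathLists n)))
          (cong₂ _+_ (total-map f (leaf ∷_) (spineLists n)) (total-map f lengthenPath (pathLists n)))

  spineList-shapes : ∀ n → All SpineList (spineLists n)
  spineList-shapes n = All.map proj₁ (spineLists-sound n)

  pathList-shapes : ∀ n → All PathList (pathLists n)
  pathList-shapes n = All.map proj₁ (pathLists-sound n)

  -- The spine length of an Elena is the number of edges
  -- v₁ … v_k of its rightmost branch; a path hanging from a spine node
  -- reaches 1 + (its height) levels below that node, and its T-excess is the
  -- part of this depth beyond T.
  mutual
    spineLength : Tree → ℕ
    spineLength (node ts) = spineLengthKids ts

    spineLengthKids : List Tree → ℕ
    spineLengthKids []           = 0
    spineLengthKids (t ∷ [])     = suc (spineLength t)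
    spineLengthKids (_ ∷ u ∷ ts) = spineLengthKids (u ∷ ts)

  mutual
    excess : ℕ → Tree → ℕ
    excess T (node ts) = excessKids T ts

    excessKids : ℕ → List Tree → ℕ
    excessKids T []           = 0
    excessKids T (t ∷ [])     = excess T t
    excessKids T (p ∷ u ∷ ts) = (suc (height p) ∸ T) + excessKids T (u ∷ ts)

  firstDepth : List Tree → ℕ
  firstDepth []      = 0
  firstDepth (p ∷ _) = suc (height p)

  reaches : ℕ → ℕ → ℕ
  reaches zero    h       = 1
  reaches (suc T) zero    = 0
  reaches (suc T) (suc h) = reaches T h

  reaches≤1 : ∀ T h → reaches T h ≤ 1
  reaches≤1 zero    h       = ≤-refl
  reaches≤1 (suc T) zero    = z≤n
  reaches≤1 (suc T) (suc h) = reaches≤1 T h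

  suc∸-reaches : ∀ T h → suc h ∸ T ≡ (h ∸ T) + reaches T h
  suc∸-reaches zero    h       = +-comm 1 h
  suc∸-reaches (suc T) zero    = 0∸n≡0 T
  suc∸-reaches (suc T) (suc h) = suc∸-reaches T h

  mutual
    spineLength≤height : ∀ t → spineLength t ≤ height t
    spineLength≤height (node ts) = spineLengthKids≤heightF ts

    spineLengthKids≤heightF : ∀ ts → spineLengthKids ts ≤ heightF ts
    spineLengthKids≤heightF []           = z≤n
    spineLengthKids≤heightF (t ∷ [])     = ≤-trans (s≤s (spineLength≤height t)) (m≤m⊔n _ 0)
    spineLengthKids≤heightF (t ∷ u ∷ ts) =
      ≤-trans (spineLengthKids≤heightF (u ∷ ts)) (m≤n⊔m (suc (height t)) _)

  attached≤spine+excess : ∀ T h s x → h ≤ s + T + ((h ∸ T) + x)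
  attached≤spine+excess T h s x = begin
    h                     ≤⟨ m≤n+m∸n h T ⟩
    T + (h ∸ T)           ≤⟨ m≤m+n _ x ⟩
    T + (h ∸ T) + x       ≤⟨ m≤n+m _ s ⟩
    s + (T + (h ∸ T) + x) ≡⟨ regroup s T (h ∸ T) x ⟩
    s + T + ((h ∸ T) + x) ∎
    where
    regroup : ∀ a b c d → a + (b + c + d) ≡ a + b + (c + d)
    regroup = solve-∀

  mutual
    height≤spine+excess : ∀ T t → height t ≤ spineLength t + T + excess T t
    height≤spine+excess T (node ts) = heightF≤spine+excess T ts

    heightF≤spine+excess : ∀ T ts → heightF ts ≤ spineLengthKids ts + T + excessKids T ts
    heightF≤spine+excess T []           = z≤n
    heightF≤spine+excess T (t ∷ [])     = ⊔-lub (s≤s (height≤spine+excess T t)) z≤n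
    heightF≤spine+excess T (p ∷ u ∷ ts) =
      ⊔-lub (attached≤spine+excess T (suc (height p)) (spineLengthKids (u ∷ ts)) (excessKids T (u ∷ ts)))
            (≤-trans (heightF≤spine+excess T (u ∷ ts))
                     (+-monoʳ-≤ (spineLengthKids (u ∷ ts) + T) (m≤n+m _ (suc (height p) ∸ T))))

  -- A tree is strictly lower than its number of nodes, hence the 1-excess of
  -- an Elena (a sum of depths of disjoint paths) is at most its size.
  mutual
    height<size : ∀ t → suc (height t) ≤ size t
    height<size (node ts) = s≤s (heightF≤sizeF ts)

    heightF≤sizeF : ∀ ts → heightF ts ≤ sizeF ts
    heightF≤sizeF []       = z≤n
    heightF≤sizeF (t ∷ ts) = ⊔-lub (≤-trans (height<size t) (m≤m+n (size t) (sizeF ts)))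
                                   (≤-trans (heightF≤sizeF ts) (m≤n+m (sizeF ts) (size t)))

  mutual
    excess₁≤size : ∀ t → excess 1 t ≤ size t
    excess₁≤size (node ts) = ≤-trans (excessKids₁≤sizeF ts) (n≤1+n _)

    excessKids₁≤sizeF : ∀ ts → excessKids 1 ts ≤ sizeF ts
    excessKids₁≤sizeF []           = z≤n
    excessKids₁≤sizeF (t ∷ [])     = ≤-trans (excess₁≤size t) (m≤m+n (size t) 0)
    excessKids₁≤sizeF (t ∷ u ∷ ts) = +-mono-≤ (≤-trans (n≤1+n _) (height<size t)) (excessKids₁≤sizeF (u ∷ ts))

  elenaCount pathCount spineTotal pathSpineTotal heightTotal : ℕ → ℕ
  elenaCount     n = total (λ _ → 1) (elenas n)
  pathCount      n = total (λ _ → 1) (pathLists n)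
  spineTotal     n = total spineLength (elenas n)
  pathSpineTotal n = total spineLengthKids (pathLists n)
  heightTotal    n = total height (elenas n)

  excessTotal pathExcessTotal reachingPaths : ℕ → ℕ → ℕ
  excessTotal     T n = total (excess T) (elenas n)
  pathExcessTotal T n = total (excessKids T) (pathLists n)
  reachingPaths   T n = total (λ ws → reaches T (firstDepth ws)) (pathLists n)

  elenaCount-rec : ∀ n → elenaCount (suc (suc n)) ≡ elenaCount (suc n) + pathCount (suc n)
  elenaCount-rec n = trans (total-map (λ _ → 1) node (spineLists (suc n))) (total-spineLists (λ _ → 1) (suc n))

  spineListCount : ∀ n → total (λ _ → 1) (spineLists n) ≡ elenaCount n + pathCount n
  spineListCount = total-spineLists (λ _ → 1)

  pathCount-rec : ∀ n → pathCount (suc n) ≡ elenaCount n + pathCount n + pathCount n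
  pathCount-rec n = trans (total-pathLists (λ _ → 1) n) (cong (_+ pathCount n) (spineListCount n))

  -- Each spine list contributes one more spine edge than its last Elena.
  spineListSpineTotal : ∀ n → total spineLengthKids (spineLists n) ≡ elenaCount n + spineTotal n + pathSpineTotal n
  spineListSpineTotal n =
    trans (total-spineLists spineLengthKids n) (cong (_+ pathSpineTotal n) (total-+ (λ _ → 1) spineLength (elenas n)))

  spineTotal-rec : ∀ n → spineTotal (suc (suc n)) ≡ elenaCount (suc n) + spineTotal (suc n) + pathSpineTotal (suc n)
  spineTotal-rec n = trans (total-map spineLength node (spineLists (suc n))) (spineListSpineTotal (suc n))

  -- Attached paths do not change the spine.
  pathSpineTotal-rec : ∀ n → pathSpineTotal (suc n) ≡ elenaCount n + spineTotal n + pathSpineTotal n + pathSpineTotal n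
  pathSpineTotal-rec n = trans (total-pathLists spineLengthKids n)
    (cong₂ _+_ (trans (total-cong (All.map spine-leaf (spineList-shapes n))) (spineListSpineTotal n))
               (total-cong (All.map spine-lengthen (pathList-shapes n))))
    where
    spine-leaf : ∀ {ws} → SpineList ws → spineLengthKids (leaf ∷ ws) ≡ spineLengthKids ws
    spine-leaf (spineList _) = refl
    spine-lengthen : ∀ {ws} → PathList ws → spineLengthKids (lengthenPath ws) ≡ spineLengthKids ws
    spine-lengthen (pathList _ _) = refl

  -- Recurrences for excess totals: a new one-node path has no (T+1)-excess,
  -- and lengthening a path adds one exactly when it reaches T.
  excessTotal-rec : ∀ T n → excessTotal T (suc (suc n)) ≡ excessTotal T (suc n) + pathExcessTotal T (suc n)
  excessTotal-rec T n = trans (total-map (excess T) node (spineLists (suc n))) (total-spineLists (excessKids T) (suc n))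

  pathExcessTotal-rec : ∀ T n → pathExcessTotal (suc T) (suc n) ≡
    (excessTotal (suc T) n + pathExcessTotal (suc T) n) + (pathExcessTotal (suc T) n + reachingPaths (suc T) n)
  pathExcessTotal-rec T n = trans (total-pathLists (excessKids (suc T)) n)
    (cong₂ _+_ (trans (total-cong (All.map excess-leaf (spineList-shapes n))) (total-spineLists (excessKids (suc T)) n))
               (trans (total-cong (All.map excess-lengthen (pathList-shapes n)))
                      (total-+ (excessKids (suc T)) (λ ws → reaches (suc T) (firstDepth ws)) (pathLists n))))
    where
    excess-leaf : ∀ {ws} → SpineList ws → excessKids (suc T) (leaf ∷ ws) ≡ excessKids (suc T) ws
    excess-leaf {q ∷ r} (spineList _) = cong (_+ excessKids (suc T) (q ∷ r)) (0∸n≡0 T)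
    excess-lengthen : ∀ {ws} → PathList ws →
      excessKids (suc T) (lengthenPath ws) ≡ excessKids (suc T) ws + reaches (suc T) (firstDepth ws)
    excess-lengthen {p ∷ ws} (pathList _ _)
      rewrite ⊔-identityʳ (suc (height p)) | suc∸-reaches (suc T) (suc (height p)) =
      swap (suc (height p) ∸ suc T) (reaches (suc T) (suc (height p))) (excessKids (suc T) ws)
      where
      swap : ∀ a b c → a + b + c ≡ a + c + b
      swap = solve-∀

  -- A path list reaches depth T + 2 only if it is a lengthened one reaching T + 1.
  reachingPaths-rec : ∀ T n → reachingPaths (suc (suc T)) (suc n) ≡ reachingPaths (suc T) n
  reachingPaths-rec T n = trans (total-pathLists (λ ws → reaches (suc (suc T)) (firstDepth ws)) n)
    (cong₂ _+_ (total-const 0 (spineLists n)) (total-cong {xs = pathLists n} (All.tabulate λ {ws} _ → reaches-lengthen ws)))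
    where
    reaches-lengthen : ∀ ws → reaches (suc (suc T)) (firstDepth (lengthenPath ws)) ≡ reaches (suc T) (firstDepth ws)
    reaches-lengthen []      = refl
    reaches-lengthen (p ∷ _) = cong (reaches (suc T)) (⊔-identityʳ (suc (height p)))

  reachingPaths₁ : ∀ n → reachingPaths 1 n ≡ pathCount n
  reachingPaths₁ n = total-cong (All.map (λ { (pathList _ _) → refl }) (pathList-shapes n))

  -- At most a 2^-T fraction of the path lists of size n start with a path
  -- reaching depth T + 1: such a list of size n + 1 reaching T + 2 comes
  -- from one of size n reaching T + 1, while the path lists at least double.
  reachingPaths-halving : ∀ T n → 2 ^ T * reachingPaths (suc T) n ≤ pathCount n
  reachingPaths-halving zero    n = ≤-trans (≤-reflexive (+-identityʳ _))
                                            (total-mono (λ ws → reaches≤1 1 (firstDepth ws)) (pathLists n))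
  reachingPaths-halving (suc T) zero    = ≤-reflexive (*-zeroʳ (2 ^ suc T))
  reachingPaths-halving (suc T) (suc n) rewrite reachingPaths-rec T n | pathCount-rec n = begin
    2 * 2 ^ T * reachingPaths (suc T) n   ≡⟨ *-assoc 2 (2 ^ T) _ ⟩
    2 * (2 ^ T * reachingPaths (suc T) n) ≤⟨ *-monoʳ-≤ 2 (reachingPaths-halving T n) ⟩
    pathCount n + (pathCount n + 0)       ≡⟨ cong (pathCount n +_) (+-identityʳ (pathCount n)) ⟩
    pathCount n + pathCount n             ≤⟨ m≤n+m _ (elenaCount n) ⟩
    elenaCount n + (pathCount n + pathCount n) ≡⟨ sym (+-assoc (elenaCount n) _ _) ⟩
    elenaCount n + pathCount n + pathCount n ∎

  -- Consequently the total (T+1)-excess is at most 2^-T times the total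
  -- 1-excess; Elenas and path lists are handled simultaneously, following
  -- the recurrences.
  ExcessHalving : ℕ → ℕ → Set
  ExcessHalving T n = (2 ^ T * excessTotal (suc T) n ≤ excessTotal 1 n)
                    × (2 ^ T * pathExcessTotal (suc T) n ≤ pathExcessTotal 1 n)

  excessTotal-halving-step : ∀ T n → ExcessHalving T n →
    2 ^ T * excessTotal (suc T) (suc n) ≤ excessTotal 1 (suc n)
  excessTotal-halving-step T zero    _ = ≤-reflexive (*-zeroʳ (2 ^ T))
  excessTotal-halving-step T (suc n) (elenaPart , pathPart)
    rewrite excessTotal-rec (suc T) n | excessTotal-rec 1 n =
    ≤-trans (≤-reflexive (*-distribˡ-+ (2 ^ T) _ _)) (+-mono-≤ elenaPart pathPart)

  pathExcessTotal-halving-step : ∀ T n → ExcessHalving T n →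
    2 ^ T * pathExcessTotal (suc T) (suc n) ≤ pathExcessTotal 1 (suc n)
  pathExcessTotal-halving-step T n (elenaPart , pathPart)
    rewrite pathExcessTotal-rec T n | pathExcessTotal-rec 0 n | reachingPaths₁ n = begin
    Z * ((eT + pT) + (pT + rT))         ≡⟨ distribute Z eT pT rT ⟩
    (Z * eT + Z * pT) + (Z * pT + Z * rT)
      ≤⟨ +-mono-≤ (+-mono-≤ elenaPart pathPart) (+-mono-≤ pathPart (reachingPaths-halving T n)) ⟩
    (excessTotal 1 n + pathExcessTotal 1 n) + (pathExcessTotal 1 n + pathCount n) ∎
    where
    Z eT pT rT : ℕ
    Z  = 2 ^ T
    eT = excessTotal (suc T) n
    pT = pathExcessTotal (suc T) n
    rT = reachingPaths (suc T) n
    distribute : ∀ z a b c → z * ((a + b) + (b + c)) ≡ (z * a + z * b) + (z * b + z * c)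
    distribute = solve-∀

  excess-halving : ∀ T n → ExcessHalving T n
  excess-halving T zero    = ≤-reflexive (*-zeroʳ (2 ^ T)) , ≤-reflexive (*-zeroʳ (2 ^ T))
  excess-halving T (suc n) =
    excessTotal-halving-step T n (excess-halving T n) , pathExcessTotal-halving-step T n (excess-halving T n)

  spineTotal≤heightTotal : ∀ n → spineTotal n ≤ heightTotal n
  spineTotal≤heightTotal n = total-mono spineLength≤height (elenas n)

  heightTotal≤ : ∀ T n → heightTotal n ≤ spineTotal n + T * elenaCount n + excessTotal T n
  heightTotal≤ T n = begin
    heightTotal n                                            ≤⟨ total-mono (height≤spine+excess T) (elenas n) ⟩
    total (λ t → spineLength t + T + excess T t) (elenas n)  ≡⟨ total-+ (λ t → spineLength t + T) (excess T) (elenas n) ⟩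
    total (λ t → spineLength t + T) (elenas n) + excessTotal T n
      ≡⟨ cong (_+ excessTotal T n) (total-+ spineLength (λ _ → T) (elenas n)) ⟩
    spineTotal n + total (λ _ → T) (elenas n) + excessTotal T n
      ≡⟨ cong (λ z → spineTotal n + z + excessTotal T n) (total-const T (elenas n)) ⟩
    spineTotal n + T * elenaCount n + excessTotal T n ∎

  excessTotal≤ : ∀ T n → 2 ^ T * excessTotal (suc T) n ≤ n * elenaCount n
  excessTotal≤ T n = begin
    2 ^ T * excessTotal (suc T) n ≤⟨ proj₁ (excess-halving T n) ⟩
    excessTotal 1 n               ≤⟨ total-mono excess₁≤size (elenas n) ⟩
    total size (elenas n)         ≡⟨ total-cong (All.map proj₂ (elenas-sound n)) ⟩
    total (λ _ → n) (elenas n)    ≡⟨ total-const n (elenas n) ⟩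
    n * elenaCount n              ∎

  -- Exact polynomial invariants of (n, #Elenas, #path lists, spine total,
  -- path spine total), preserved by the recurrences.  The first is a
  -- Cassini-type identity forcing #path lists / #Elenas → golden ratio; the
  -- second expresses the spine total through the counts.
  record Invariants (m e u d f : ℕ) : Set where
    field
      cassini           : e * e + u * e ≡ u * u + 1
      spineIdentity     : 5 * d + 3 * e + m * u ≡ 3 * m * e + 4 * u
      pathSpineIdentity : 5 * f + m * e ≡ 2 * m * u + e + 2 * u
      paths≤2elenas     : u ≤ 2 * e
      size≤paths+1      : m ≤ u + 1
      elenas≥1          : 1 ≤ e

  cancel-equal : ∀ {x y a b} → a ≡ b → x + a ≡ y + b → x ≡ y
  cancel-equal {x} {y} {a} refl eq = +-cancelʳ-≡ a x y eq

  invariants-step : ∀ {m e u d f} → Invariants m e u d f →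
    Invariants (suc m) (e + u) (e + u + u) (e + d + f) (e + d + f + f)
  invariants-step {m} {e} {u} {d} {f} inv = record
    { cassini           = cancel-equal (sym cassini) (cassini-step e u)
    ; spineIdentity     = cancel-equal (cong₂ _+_ (sym spineIdentity) (sym pathSpineIdentity)) (spine-step m e u d f)
    ; pathSpineIdentity = cancel-equal (cong₂ _+_ (sym spineIdentity) (cong (2 *_) (sym pathSpineIdentity)))
                                       (pathSpine-step m e u d f)
    ; paths≤2elenas     = ≤-trans (+-monoʳ-≤ (e + u) (m≤n+m u e)) (≤-reflexive (sym (double (e + u))))
    ; size≤paths+1      = ≤-trans (s≤s size≤paths+1) (+-monoˡ-≤ 1 (≤-trans (+-monoˡ-≤ u elenas≥1) (m≤m+n (e + u) u)))
    ; elenas≥1          = ≤-trans elenas≥1 (m≤m+n e u)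
    }
    where
    open Invariants inv
    cassini-step : ∀ e u → (e + u) * (e + u) + (e + u + u) * (e + u) + (u * u + 1)
                         ≡ (e + u + u) * (e + u + u) + 1 + (e * e + u * e)
    cassini-step = solve-∀
    spine-step : ∀ m e u d f →
      5 * (e + d + f) + 3 * (e + u) + suc m * (e + u + u) + (3 * m * e + 4 * u + (2 * m * u + e + 2 * u))
      ≡ 3 * suc m * (e + u) + 4 * (e + u + u) + (5 * d + 3 * e + m * u + (5 * f + m * e))
    spine-step = solve-∀
    pathSpine-step : ∀ m e u d f →
      5 * (e + d + f + f) + suc m * (e + u) + (3 * m * e + 4 * u + 2 * (2 * m * u + e + 2 * u))
      ≡ 2 * suc m * (e + u + u) + (e + u) + 2 * (e + u + u) + (5 * d + 3 * e + m * u + 2 * (5 * f + m * e))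
    pathSpine-step = solve-∀
    double : ∀ x → 2 * x ≡ x + x
    double = solve-∀

  invariants : ∀ n → Invariants (suc n) (elenaCount (suc n)) (pathCount (suc n)) (spineTotal (suc n)) (pathSpineTotal (suc n))
  invariants zero = record
    { cassini = refl ; spineIdentity = refl ; pathSpineIdentity = refl
    ; paths≤2elenas = z≤n ; size≤paths+1 = s≤s z≤n ; elenas≥1 = s≤s z≤n }
  invariants (suc n)
    rewrite elenaCount-rec n | pathCount-rec (suc n) | spineTotal-rec n | pathSpineTotal-rec (suc n) =
    invariants-step (invariants n)

  elenaCount≤pathCount : ∀ n → elenaCount (suc (suc n)) ≤ pathCount (suc (suc n))
  elenaCount≤pathCount n rewrite elenaCount-rec n | pathCount-rec (suc n) = m≤m+n _ _


module RationalEstimates where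

  open import Data.Nat as ℕ using (ℕ)
  open import Data.Integer as ℤ using (+_; -[1+_])
  import Data.Integer.Properties as ℤ
  open import Data.Rational using (ℚ; _/_; mkℚ; 0ℚ; 1ℚ; _+_; _*_; _-_; -_; _<_; _≤_; *<*; *≤*; 1/_; positive; nonNegative)
  open import Data.Rational.Properties
  open import Algebra.Properties.Group +-0-group using (∙-cancelʳ)
  open import Data.Rational.Solver using (module +-*-Solver)
  open +-*-Solver
  open import Data.Nat.Coprimality using (1-coprimeTo) renaming (sym to coprime-sym)
  open import Data.Empty using (⊥-elim)
  open import Data.Product using (_×_; _,_; proj₁; proj₂; Σ; ∃-syntax)
  open import Data.Sum using (inj₁; inj₂)
  open import Relation.Nullary using (¬_; yes; no)
  open import Relation.Binary.PropositionalEquality using (_≡_; refl; sym; trans; cong; subst; subst₂)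

  toℚ≡mkℚ : ∀ n → toℚ n ≡ mkℚ (+ n) 0 (coprime-sym (1-coprimeTo n))
  toℚ≡mkℚ n = ↥p/↧p≡p (mkℚ (+ n) 0 (coprime-sym (1-coprimeTo n)))

  toℚ-+ : ∀ m n → toℚ (m ℕ.+ n) ≡ toℚ m + toℚ n
  toℚ-+ m n rewrite toℚ≡mkℚ m | toℚ≡mkℚ n | ℤ.*-identityʳ (+ m) | ℤ.*-identityʳ (+ n) = refl

  toℚ-* : ∀ m n → toℚ (m ℕ.* n) ≡ toℚ m * toℚ n
  toℚ-* m n rewrite toℚ≡mkℚ m | toℚ≡mkℚ n | ℤ.+◃n≡+n (m ℕ.* n) = refl

  toℚ-mono-≤ : ∀ {m n} → m ℕ.≤ n → toℚ m ≤ toℚ n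
  toℚ-mono-≤ {m} {n} m≤n rewrite toℚ≡mkℚ m | toℚ≡mkℚ n = *≤* (ℤ.*-monoʳ-≤-nonNeg (+ 1) (ℤ.+≤+ m≤n))

  toℚ-mono-< : ∀ {m n} → m ℕ.< n → toℚ m < toℚ n
  toℚ-mono-< {m} {n} m<n rewrite toℚ≡mkℚ m | toℚ≡mkℚ n = *<* (ℤ.*-monoʳ-<-pos (+ 1) (ℤ.+<+ m<n))

  toℚ-nonNeg : ∀ n → 0ℚ ≤ toℚ n
  toℚ-nonNeg n = toℚ-mono-≤ {0} {n} ℕ.z≤n

  toℚ-unbounded : ∀ c → ∃[ n ] c ≤ toℚ n
  toℚ-unbounded (mkℚ (+ m) d cp) = m , subst (mkℚ (+ m) d cp ≤_) (sym (toℚ≡mkℚ m))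
    (*≤* (ℤ.*-monoˡ-≤-nonNeg (+ m) (ℤ.+≤+ (ℕ.s≤s ℕ.z≤n))))
  toℚ-unbounded (mkℚ -[1+ m ] d cp) = 0 , subst (mkℚ -[1+ m ] d cp ≤_) (sym (toℚ≡mkℚ 0)) (*≤* ℤ.-≤+)

  archimedean : ∀ c δ → 0ℚ < δ → ∃[ n ] c ≤ δ * toℚ n
  archimedean c δ δ>0 = n , subst (_≤ δ * toℚ n) δ*c/δ≡c (*-monoˡ-≤-nonNeg δ {{nonNegative (<⇒≤ δ>0)}} c/δ≤n)
    where
    instance _ = pos⇒nonZero δ {{positive δ>0}}
    n : ℕ
    n = proj₁ (toℚ-unbounded (c * 1/ δ))
    c/δ≤n : c * 1/ δ ≤ toℚ n
    c/δ≤n = proj₂ (toℚ-unbounded (c * 1/ δ))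
    δ*c/δ≡c : δ * (c * 1/ δ) ≡ c
    δ*c/δ≡c = trans (solve 3 (λ d c i → d :* (c :* i) := c :* (d :* i)) refl δ c (1/ δ))
                    (trans (cong (c *_) (*-inverseʳ δ)) (*-identityʳ c))

  p<q⇒0<q-p : ∀ {p q} → p < q → 0ℚ < q - p
  p<q⇒0<q-p {p} {q} p<q = subst (_< q - p) (+-inverseʳ p) (+-monoˡ-< (- p) p<q)

  p≤q⇒0≤q-p : ∀ {p q} → p ≤ q → 0ℚ ≤ q - p
  p≤q⇒0≤q-p {p} {q} p≤q = subst (_≤ q - p) (+-inverseʳ p) (+-monoˡ-≤ (- p) p≤q)

  q-p+p≡q : ∀ q p → (q - p) + p ≡ q
  q-p+p≡q = solve 2 (λ q p → (q :- p) :+ p := q) refl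

  0<q-p⇒p<q : ∀ {p q} → 0ℚ < q - p → p < q
  0<q-p⇒p<q {p} {q} 0<q-p = subst₂ _<_ (+-identityˡ p) (q-p+p≡q q p) (+-monoˡ-< p 0<q-p)

  0≤q-p⇒p≤q : ∀ {p q} → 0ℚ ≤ q - p → p ≤ q
  0≤q-p⇒p≤q {p} {q} 0≤q-p = subst₂ _≤_ (+-identityˡ p) (q-p+p≡q q p) (+-monoˡ-≤ p 0≤q-p)

  0<p*q : ∀ {p q} → 0ℚ < p → 0ℚ < q → 0ℚ < p * q
  0<p*q {p} {q} 0<p 0<q = positive⁻¹ (p * q) {{pos*pos⇒pos p {{positive 0<p}} q {{positive 0<q}}}}

  0≤p*q : ∀ {p q} → 0ℚ ≤ p → 0ℚ ≤ q → 0ℚ ≤ p * q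
  0≤p*q {p} {q} 0≤p 0≤q =
    nonNegative⁻¹ (p * q) {{nonNeg*nonNeg⇒nonNeg p {{nonNegative 0≤p}} q {{nonNegative 0≤q}}}}

  scaleˡ-≤ : ∀ {r p q} → 0ℚ ≤ r → p ≤ q → r * p ≤ r * q
  scaleˡ-≤ {r} 0≤r = *-monoˡ-≤-nonNeg r {{nonNegative 0≤r}}

  scaleʳ-≤ : ∀ {r p q} → 0ℚ ≤ r → p ≤ q → p * r ≤ q * r
  scaleʳ-≤ {r} 0≤r = *-monoʳ-≤-nonNeg r {{nonNegative 0≤r}}

  square-mono-≤ : ∀ {p q} → 0ℚ ≤ p → p ≤ q → p * p ≤ q * q
  square-mono-≤ {p} {q} 0≤p p≤q =
    ≤-trans (scaleˡ-≤ 0≤p p≤q) (subst (_≤ q * q) (*-comm q p) (scaleˡ-≤ (≤-trans 0≤p p≤q) p≤q))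

  square-reflects-< : ∀ {p q} → 0ℚ ≤ q → p * p < q * q → p < q
  square-reflects-< {p} {q} 0≤q p²<q² with p <? q
  ... | yes p<q = p<q
  ... | no  p≮q = ⊥-elim (<-irrefl refl (<-≤-trans p²<q² (square-mono-≤ 0≤q (≮⇒≥ p≮q))))

  cancel-pos : ∀ c {y} → 0ℚ < c → 0ℚ < c * y → 0ℚ < y
  cancel-pos c {y} 0<c 0<cy =
    *-cancelˡ-<-nonNeg c {{nonNegative (<⇒≤ 0<c)}} (subst (_< c * y) (sym (*-zeroʳ c)) 0<cy)

  cancel-equalℚ : ∀ {x y a b} → a ≡ b → x + a ≡ y + b → x ≡ y
  cancel-equalℚ {x} {y} {a} refl eq = ∙-cancelʳ a x y eq

  -- The Cassini identity for (E, U) is a Pell equation x² + 4 = 5E² for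
  -- x = 2U - E; in particular x < √5 · E.
  pell : ∀ {E U} → E * E + U * E ≡ U * U + toℚ 1 →
    (toℚ 2 * U - E) * (toℚ 2 * U - E) + toℚ 4 ≡ toℚ 5 * (E * E)
  pell {E} {U} cassini = cancel-equalℚ (cong (toℚ 4 *_) cassini) (identity U E)
    where
    identity : ∀ U E → (toℚ 2 * U - E) * (toℚ 2 * U - E) + toℚ 4 + toℚ 4 * (E * E + U * E)
                     ≡ toℚ 5 * (E * E) + toℚ 4 * (U * U + toℚ 1)
    identity = solve 2 (λ U E →
      (con (toℚ 2) :* U :- E) :* (con (toℚ 2) :* U :- E) :+ con (toℚ 4) :+ con (toℚ 4) :* (E :* E :+ U :* E)
      := con (toℚ 5) :* (E :* E) :+ con (toℚ 4) :* (U :* U :+ con (toℚ 1))) refl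

  pell-< : ∀ {x E} → x * x + toℚ 4 ≡ toℚ 5 * (E * E) → x * x < toℚ 5 * (E * E)
  pell-< {x} pell-eq =
    subst (x * x <_) pell-eq (subst (_< x * x + toℚ 4) (+-identityʳ (x * x)) (+-monoʳ-< (x * x) (positive⁻¹ (toℚ 4))))

  pell-nonNeg : ∀ {E U} → 0ℚ ≤ E → E ≤ U → 0ℚ ≤ toℚ 2 * U - E
  pell-nonNeg {E} {U} 0≤E E≤U =
    subst (0ℚ ≤_) (identity U E) (+-mono-≤ (p≤q⇒0≤q-p E≤U) (≤-trans 0≤E E≤U))
    where
    identity : ∀ U E → (U - E) + U ≡ toℚ 2 * U - E
    identity = solve 2 (λ U E → (U :- E) :+ U := con (toℚ 2) :* U :- E) refl

  -- Lower estimate.  Write r = 5 - 10a > √5.  The spine identity gives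
  -- 10 (D - a E N) = N (r E - x) + 8 (U - E) + 2E with x = 2U - E < √5 E < r E.
  lower-estimate : ∀ {a E U N D} → LtC a → toℚ 1 ≤ E → E ≤ U → 0ℚ ≤ N →
    E * E + U * E ≡ U * U + toℚ 1 →
    toℚ 5 * D + toℚ 3 * E + N * U ≡ toℚ 3 * N * E + toℚ 4 * U →
    a * (E * N) < D
  lower-estimate {a} {E} {U} {N} {D} (0<r , 5<r²) 1≤E E≤U 0≤N cassini spineIdentity =
    0<q-p⇒p<q (cancel-pos (toℚ 10) (positive⁻¹ (toℚ 10)) (subst (0ℚ <_) (sym decomposition) positive-sum))
    where
    r x : ℚ
    r = toℚ 5 - toℚ 10 * a
    x = toℚ 2 * U - E
    0<E : 0ℚ < E
    0<E = <-≤-trans (positive⁻¹ 1ℚ) 1≤E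
    x<rE : x < r * E
    x<rE = square-reflects-< (0≤p*q (<⇒≤ 0<r) (<⇒≤ 0<E)) (<-trans (pell-< {x} {E} (pell {E} {U} cassini)) 5E²<rE²)
      where
      5E²<rE² : toℚ 5 * (E * E) < (r * E) * (r * E)
      5E²<rE² = subst₂ _<_ (*-comm (E * E) (toℚ 5))
        (solve 2 (λ r E → (E :* E) :* (r :* r) := (r :* E) :* (r :* E)) refl r E)
        (*-monoʳ-<-pos (E * E) {{positive (0<p*q 0<E 0<E)}} 5<r²)
    decomposition : toℚ 10 * (D - a * (E * N)) ≡ N * (r * E - x) + (toℚ 8 * (U - E) + toℚ 2 * E)
    decomposition = cancel-equalℚ (cong (toℚ 2 *_) (sym spineIdentity)) (identity a E U N D)
      where
      identity : ∀ a E U N D →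
        toℚ 10 * (D - a * (E * N)) + toℚ 2 * (toℚ 3 * N * E + toℚ 4 * U)
        ≡ N * ((toℚ 5 - toℚ 10 * a) * E - (toℚ 2 * U - E)) + (toℚ 8 * (U - E) + toℚ 2 * E)
          + toℚ 2 * (toℚ 5 * D + toℚ 3 * E + N * U)
      identity = solve 5 (λ a E U N D →
        con (toℚ 10) :* (D :- a :* (E :* N)) :+ con (toℚ 2) :* (con (toℚ 3) :* N :* E :+ con (toℚ 4) :* U)
        := N :* ((con (toℚ 5) :- con (toℚ 10) :* a) :* E :- (con (toℚ 2) :* U :- E))
           :+ (con (toℚ 8) :* (U :- E) :+ con (toℚ 2) :* E)
           :+ con (toℚ 2) :* (con (toℚ 5) :* D :+ con (toℚ 3) :* E :+ N :* U)) refl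
    positive-sum : 0ℚ < N * (r * E - x) + (toℚ 8 * (U - E) + toℚ 2 * E)
    positive-sum = +-mono-≤-< (0≤p*q 0≤N (<⇒≤ (p<q⇒0<q-p x<rE)))
      (+-mono-≤-< (0≤p*q (<⇒≤ (positive⁻¹ (toℚ 8))) (p≤q⇒0≤q-p E≤U)) (0<p*q (positive⁻¹ (toℚ 2)) 0<E))

  -- For v = 5 - 10b < √5, the quantity x - vE (with x ≈ √5 E) eventually
  -- exceeds a fixed positive multiple δ E of E.
  Margin : ℚ → ℚ → ℕ → Set
  Margin b δ M = ∀ E x → 0ℚ ≤ x → x * x + toℚ 4 ≡ toℚ 5 * (E * E) → toℚ 1 ≤ E → toℚ M ≤ E →
                 δ * E ≤ x - (toℚ 5 - toℚ 10 * b) * E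

  margin-negative : ∀ b → toℚ 5 - toℚ 10 * b < 0ℚ → Margin b (0ℚ - (toℚ 5 - toℚ 10 * b)) 0
  margin-negative b _ E x 0≤x _ _ _ = 0≤q-p⇒p≤q (subst (0ℚ ≤_) (identity x (toℚ 5 - toℚ 10 * b) E) 0≤x)
    where
    identity : ∀ x v E → x ≡ (x - v * E) - ((0ℚ - v) * E)
    identity = solve 3 (λ x v E → x := (x :- v :* E) :- ((con 0ℚ :- v) :* E)) refl

  twelfth half : ℚ
  twelfth = + 1 / 12
  half    = + 1 / 2

  -- For 0 ≤ v < √5 put w = 5 - v².  Then (x - vE)(x + vE) = wE² - 4 and
  -- x + vE ≤ 6E, so x - vE < (w/12) E would give wE² - 4 ≤ wE²/2, which
  -- fails once wE² ≥ 9.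
  margin-nonNegative : ∀ {v M} → 0ℚ ≤ v → v * v < toℚ 5 → toℚ 9 ≤ (toℚ 5 - v * v) * toℚ M →
    ∀ E x → 0ℚ ≤ x → x * x + toℚ 4 ≡ toℚ 5 * (E * E) → toℚ 1 ≤ E → toℚ M ≤ E →
    ((toℚ 5 - v * v) * twelfth) * E ≤ x - v * E
  margin-nonNegative {v} {M} 0≤v v²<5 9≤wM E x 0≤x pell-eq 1≤E M≤E = ≮⇒≥ y≮δE
    where
    w δ Z : ℚ
    w = toℚ 5 - v * v
    δ = w * twelfth
    Z = w * (E * E)
    0≤E : 0ℚ ≤ E
    0≤E = ≤-trans (nonNegative⁻¹ 1ℚ) 1≤E
    5<9 : toℚ 5 < toℚ 9
    5<9 = toℚ-mono-< {5} {9} (ℕ.s≤s (ℕ.s≤s (ℕ.s≤s (ℕ.s≤s (ℕ.s≤s (ℕ.s≤s ℕ.z≤n))))))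
    x≤3E : x ≤ toℚ 3 * E
    x≤3E = <⇒≤ (square-reflects-< (0≤p*q (nonNegative⁻¹ (toℚ 3)) 0≤E) (<-≤-trans (pell-< {x} {E} pell-eq) 5E²≤9E²))
      where
      5E²≤9E² : toℚ 5 * (E * E) ≤ (toℚ 3 * E) * (toℚ 3 * E)
      5E²≤9E² = subst (toℚ 5 * (E * E) ≤_) (solve 1 (λ E → con (toℚ 9) :* (E :* E) := (con (toℚ 3) :* E) :* (con (toℚ 3) :* E)) refl E)
                      (scaleʳ-≤ (0≤p*q 0≤E 0≤E) (<⇒≤ 5<9))
    v≤3 : v ≤ toℚ 3
    v≤3 = <⇒≤ (square-reflects-< (nonNegative⁻¹ (toℚ 3)) (<-trans v²<5 5<9))
    s : ℚ
    s = x + v * E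
    s≤6E : s ≤ toℚ 6 * E
    s≤6E = subst (s ≤_) (solve 1 (λ E → con (toℚ 3) :* E :+ con (toℚ 3) :* E := con (toℚ 6) :* E) refl E)
                 (+-mono-≤ x≤3E (scaleʳ-≤ 0≤E v≤3))
    product : (x - v * E) * s ≡ Z - toℚ 4
    product = cancel-equalℚ (sym pell-eq) (identity x v E)
      where
      identity : ∀ x v E → (x - v * E) * (x + v * E) + toℚ 5 * (E * E) ≡ (toℚ 5 - v * v) * (E * E) - toℚ 4 + (x * x + toℚ 4)
      identity = solve 3 (λ x v E → (x :- v :* E) :* (x :+ v :* E) :+ con (toℚ 5) :* (E :* E)
                               := (con (toℚ 5) :- v :* v) :* (E :* E) :- con (toℚ 4) :+ (x :* x :+ con (toℚ 4))) refl
    9≤Z : toℚ 9 ≤ Z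
    9≤Z = ≤-trans 9≤wM (scaleˡ-≤ (<⇒≤ (p<q⇒0<q-p v²<5)) (≤-trans M≤E E≤E²))
      where
      E≤E² : E ≤ E * E
      E≤E² = subst (_≤ E * E) (*-identityʳ E) (scaleˡ-≤ 0≤E 1≤E)
    y≮δE : ¬ (x - v * E < δ * E)
    y≮δE y<δE = <-irrefl refl (<-≤-trans (negative⁻¹ (- half)) 0≤-half)
      where
      Z-4≤Z/2 : Z - toℚ 4 ≤ half * Z
      Z-4≤Z/2 = subst₂ _≤_ product
        (solve 2 (λ w E → (w :* con twelfth :* E) :* (con (toℚ 6) :* E) := con half :* (w :* (E :* E))) refl w E)
        (≤-trans (scaleʳ-≤ (+-mono-≤ 0≤x (0≤p*q 0≤v 0≤E)) (<⇒≤ y<δE))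
                 (scaleˡ-≤ (0≤p*q (0≤p*q (<⇒≤ (p<q⇒0<q-p v²<5)) (nonNegative⁻¹ twelfth)) 0≤E) s≤6E))
      0≤-half : 0ℚ ≤ - half
      0≤-half = subst (0ℚ ≤_)
        (solve 1 (λ Z → con half :* (Z :- con (toℚ 9)) :+ (con half :* Z :- (Z :- con (toℚ 4))) := :- con half) refl Z)
        (+-mono-≤ (0≤p*q (nonNegative⁻¹ half) (p≤q⇒0≤q-p 9≤Z)) (p≤q⇒0≤q-p Z-4≤Z/2))

  margin : ∀ b → CLt b → Σ ℚ λ δ → (0ℚ < δ) × ∃[ M ] Margin b δ M
  margin b c<b with toℚ 5 - toℚ 10 * b <? 0ℚ | c<b
  ... | yes v<0 | _       = 0ℚ - (toℚ 5 - toℚ 10 * b) , p<q⇒0<q-p v<0 , 0 , margin-negative b v<0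
  ... | no  v≮0 | inj₁ v<0 = ⊥-elim (v≮0 v<0)
  ... | no  v≮0 | inj₂ v²<5 =
    w * twelfth , 0<p*q 0<w (positive⁻¹ twelfth) , M , margin-nonNegative {M = M} (≮⇒≥ v≮0) v²<5 9≤wM
    where
    v w : ℚ
    v = toℚ 5 - toℚ 10 * b
    w = toℚ 5 - v * v
    0<w : 0ℚ < w
    0<w = p<q⇒0<q-p v²<5
    M : ℕ
    M = proj₁ (archimedean (toℚ 9) w 0<w)
    9≤wM : toℚ 9 ≤ w * toℚ M
    9≤wM = proj₂ (archimedean (toℚ 9) w 0<w)

  fortieth threeQuarters : ℚ
  fortieth      = + 1 / 40
  threeQuarters = + 3 / 4

  -- If H ≤ D + T E + X, the margin δ E ≤ x - v E holds,
  -- 40 X ≤ δ N E and δ N ≥ 32 + 20 T, then H < b E N: by the spine identity,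
  -- 10 (b E N - (D + T E + X)) is a sum of nonnegative terms and 6E > 0.
  upper-estimate : ∀ {b δ E U N D H X T} → toℚ 1 ≤ E → U ≤ toℚ 2 * E → 0ℚ ≤ N → 0ℚ ≤ T →
    δ * E ≤ (toℚ 2 * U - E) - (toℚ 5 - toℚ 10 * b) * E →
    toℚ 5 * D + toℚ 3 * E + N * U ≡ toℚ 3 * N * E + toℚ 4 * U →
    H ≤ D + T * E + X →
    toℚ 40 * X ≤ δ * (N * E) →
    toℚ 32 + toℚ 20 * T ≤ δ * N →
    H < b * (E * N)
  upper-estimate {b} {δ} {E} {U} {N} {D} {H} {X} {T} 1≤E U≤2E 0≤N 0≤T margin-E spineIdentity H≤S 40X≤δNE N-large =
    ≤-<-trans H≤S (0<q-p⇒p<q (cancel-pos (toℚ 10) (positive⁻¹ (toℚ 10)) (subst (0ℚ <_) (sym decomposition) positive-sum)))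
    where
    0<E : 0ℚ < E
    0<E = <-≤-trans (positive⁻¹ 1ℚ) 1≤E
    t₁ t₂ t₃ t₄ t₅ : ℚ
    t₁ = N * (((toℚ 2 * U - E) - (toℚ 5 - toℚ 10 * b) * E) - δ * E)
    t₂ = toℚ 8 * (toℚ 2 * E - U)
    t₃ = toℚ 6 * E
    t₄ = toℚ 10 * (fortieth * (δ * (N * E)) - X)
    t₅ = E * (threeQuarters * (δ * N) - toℚ 16 - toℚ 10 * T)
    decomposition : toℚ 10 * (b * (E * N) - (D + T * E + X)) ≡ t₁ + t₂ + t₃ + t₄ + t₅
    decomposition = cancel-equalℚ (cong (toℚ 2 *_) spineIdentity) (identity b δ E U N D X T)
      where
      identity : ∀ b δ E U N D X T →
        toℚ 10 * (b * (E * N) - (D + T * E + X)) + toℚ 2 * (toℚ 5 * D + toℚ 3 * E + N * U)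
        ≡ N * (((toℚ 2 * U - E) - (toℚ 5 - toℚ 10 * b) * E) - δ * E) + toℚ 8 * (toℚ 2 * E - U) + toℚ 6 * E
          + toℚ 10 * (fortieth * (δ * (N * E)) - X) + E * (threeQuarters * (δ * N) - toℚ 16 - toℚ 10 * T)
          + toℚ 2 * (toℚ 3 * N * E + toℚ 4 * U)
      identity = solve 8 (λ b δ E U N D X T →
        con (toℚ 10) :* (b :* (E :* N) :- (D :+ T :* E :+ X)) :+ con (toℚ 2) :* (con (toℚ 5) :* D :+ con (toℚ 3) :* E :+ N :* U)
        := N :* (((con (toℚ 2) :* U :- E) :- (con (toℚ 5) :- con (toℚ 10) :* b) :* E) :- δ :* E)
           :+ con (toℚ 8) :* (con (toℚ 2) :* E :- U) :+ con (toℚ 6) :* E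
           :+ con (toℚ 10) :* (con fortieth :* (δ :* (N :* E)) :- X)
           :+ E :* (con threeQuarters :* (δ :* N) :- con (toℚ 16) :- con (toℚ 10) :* T)
           :+ con (toℚ 2) :* (con (toℚ 3) :* N :* E :+ con (toℚ 4) :* U)) refl
    0≤t₁ : 0ℚ ≤ t₁
    0≤t₁ = 0≤p*q 0≤N (p≤q⇒0≤q-p margin-E)
    0≤t₂ : 0ℚ ≤ t₂
    0≤t₂ = 0≤p*q (nonNegative⁻¹ (toℚ 8)) (p≤q⇒0≤q-p U≤2E)
    0≤t₃ : 0ℚ ≤ t₃
    0≤t₃ = 0≤p*q (nonNegative⁻¹ (toℚ 6)) (<⇒≤ 0<E)
    0≤t₄ : 0ℚ ≤ t₄
    0≤t₄ = 0≤p*q (nonNegative⁻¹ (toℚ 10)) (p≤q⇒0≤q-p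
      (subst (_≤ fortieth * (δ * (N * E))) (solve 1 (λ X → con fortieth :* (con (toℚ 40) :* X) := X) refl X)
             (scaleˡ-≤ (nonNegative⁻¹ fortieth) 40X≤δNE)))
    0<t₅ : 0ℚ < t₅
    0<t₅ = 0<p*q 0<E (subst (0ℚ <_) (identity N δ T)
      (+-mono-≤-< (0≤p*q (nonNegative⁻¹ threeQuarters) (p≤q⇒0≤q-p N-large))
                  (+-mono-≤-< (0≤p*q (nonNegative⁻¹ (toℚ 5)) 0≤T) (positive⁻¹ (toℚ 8)))))
      where
      identity : ∀ N δ T → threeQuarters * (δ * N - (toℚ 32 + toℚ 20 * T)) + (toℚ 5 * T + toℚ 8)
                         ≡ threeQuarters * (δ * N) - toℚ 16 - toℚ 10 * T
      identity = solve 3 (λ N δ T → con threeQuarters :* (δ :* N :- (con (toℚ 32) :+ con (toℚ 20) :* T))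
                                     :+ (con (toℚ 5) :* T :+ con (toℚ 8))
                                  := con threeQuarters :* (δ :* N) :- con (toℚ 16) :- con (toℚ 10) :* T) refl
    positive-sum : 0ℚ < t₁ + t₂ + t₃ + t₄ + t₅
    positive-sum = +-mono-≤-< (+-mono-≤ (+-mono-≤ (+-mono-≤ 0≤t₁ 0≤t₂) 0≤t₃) 0≤t₄) 0<t₅


open Enumeration
open HeightStatistics
open RationalEstimates
open import Data.Nat as ℕ using (ℕ; suc; _^_; z≤n; s≤s)
import Data.Nat.Properties as ℕ
open import Data.Nat.ListAction using (sum)
open import Data.Nat.ListAction.Properties using (sum-↭)
open import Data.List using (List; length; map)
open import Data.List.Relation.Binary.Permutation.Propositional.Properties using (↭-length; map⁺)
open import Data.Rational using (ℚ; 0ℚ; _+_; _*_; _-_; _<_; _≤_)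
open import Data.Rational.Properties using (≤-trans; <-≤-trans; <⇒≤; *-assoc; module ≤-Reasoning)
open import Data.Product using (_×_; _,_; proj₁; proj₂; ∃-syntax)
open import Relation.Binary.PropositionalEquality using (_≡_; sym; trans; cong; cong₂; subst; subst₂)

cassiniℚ : ∀ e u → e ℕ.* e ℕ.+ u ℕ.* e ≡ u ℕ.* u ℕ.+ 1 →
  toℚ e * toℚ e + toℚ u * toℚ e ≡ toℚ u * toℚ u + toℚ 1
cassiniℚ e u eq = trans (sym lhs) (trans (cong toℚ eq) rhs)
  where
  lhs : toℚ (e ℕ.* e ℕ.+ u ℕ.* e) ≡ toℚ e * toℚ e + toℚ u * toℚ e
  lhs = trans (toℚ-+ (e ℕ.* e) (u ℕ.* e)) (cong₂ _+_ (toℚ-* e e) (toℚ-* u e))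
  rhs : toℚ (u ℕ.* u ℕ.+ 1) ≡ toℚ u * toℚ u + toℚ 1
  rhs = trans (toℚ-+ (u ℕ.* u) 1) (cong (_+ toℚ 1) (toℚ-* u u))

spineIdentityℚ : ∀ m e u d → 5 ℕ.* d ℕ.+ 3 ℕ.* e ℕ.+ m ℕ.* u ≡ 3 ℕ.* m ℕ.* e ℕ.+ 4 ℕ.* u →
  toℚ 5 * toℚ d + toℚ 3 * toℚ e + toℚ m * toℚ u ≡ toℚ 3 * toℚ m * toℚ e + toℚ 4 * toℚ u
spineIdentityℚ m e u d eq = trans (sym lhs) (trans (cong toℚ eq) rhs)
  where
  lhs : toℚ (5 ℕ.* d ℕ.+ 3 ℕ.* e ℕ.+ m ℕ.* u) ≡ toℚ 5 * toℚ d + toℚ 3 * toℚ e + toℚ m * toℚ u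
  lhs = trans (toℚ-+ (5 ℕ.* d ℕ.+ 3 ℕ.* e) (m ℕ.* u))
              (cong₂ _+_ (trans (toℚ-+ (5 ℕ.* d) (3 ℕ.* e)) (cong₂ _+_ (toℚ-* 5 d) (toℚ-* 3 e))) (toℚ-* m u))
  rhs : toℚ (3 ℕ.* m ℕ.* e ℕ.+ 4 ℕ.* u) ≡ toℚ 3 * toℚ m * toℚ e + toℚ 4 * toℚ u
  rhs = trans (toℚ-+ (3 ℕ.* m ℕ.* e) (4 ℕ.* u))
              (cong₂ _+_ (trans (toℚ-* (3 ℕ.* m) e) (cong (_* toℚ e) (toℚ-* 3 m))) (toℚ-* 4 u))

heightTotal-lower : ∀ a → LtC a → ∀ n → 2 ℕ.≤ n →
  a * toℚ (elenaCount n ℕ.* n) < toℚ (heightTotal n)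
heightTotal-lower a a<c n@(suc (suc j)) _ =
  subst (λ q → a * q < toℚ (heightTotal n)) (sym (toℚ-* e n))
    (<-≤-trans (lower-estimate {a} a<c (toℚ-mono-≤ elenas≥1) (toℚ-mono-≤ (elenaCount≤pathCount j)) (toℚ-nonNeg n)
                               (cassiniℚ e (pathCount n) cassini) (spineIdentityℚ n e (pathCount n) (spineTotal n) spineIdentity))
               (toℚ-mono-≤ (spineTotal≤heightTotal n)))
  where
  e : ℕ
  e = elenaCount n
  open Invariants (invariants (suc j))
heightTotal-lower _ _ 0 ()
heightTotal-lower _ _ 1 (s≤s ())

-- Since n ≤ #path lists + 1 ≤ 2 · #Elenas + 1, there are at least M Elenas
-- of every size n ≥ 2M + 1.
elenaCount-large : ∀ M j → 2 ℕ.* M ℕ.+ 1 ℕ.≤ suc j → M ℕ.≤ elenaCount (suc j)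
elenaCount-large M j 2M+1≤n = ℕ.*-cancelˡ-≤ 2 (ℕ.+-cancelʳ-≤ 1 (2 ℕ.* M) (2 ℕ.* elenaCount (suc j))
  (ℕ.≤-trans 2M+1≤n (ℕ.≤-trans size≤paths+1 (ℕ.+-monoˡ-≤ 1 paths≤2elenas))))
  where open Invariants (invariants j)

-- Lets a threshold T stand in for the halving factor 2^T.
n≤2^n : ∀ n → n ℕ.≤ 2 ^ n
n≤2^n 0       = z≤n
n≤2^n (suc n) = ℕ.≤-trans (s≤s (n≤2^n n))
  (ℕ.≤-trans (ℕ.+-monoˡ-≤ (2 ^ n) (ℕ.m^n>0 2 n)) (ℕ.≤-reflexive (cong (2 ^ n ℕ.+_) (sym (ℕ.+-identityʳ (2 ^ n))))))

excessTotal-small : ∀ {δ T} → 0ℚ < δ → toℚ 40 ≤ δ * toℚ T → ∀ n →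
  toℚ 40 * toℚ (excessTotal (suc T) n) ≤ δ * (toℚ n * toℚ (elenaCount n))
excessTotal-small {δ} {T} 0<δ 40≤δT n = begin
  toℚ 40 * X                 ≤⟨ scaleʳ-≤ (toℚ-nonNeg (excessTotal (suc T) n)) (≤-trans 40≤δT (scaleˡ-≤ 0≤δ (toℚ-mono-≤ (n≤2^n T)))) ⟩
  (δ * toℚ (2 ^ T)) * X      ≡⟨ *-assoc δ (toℚ (2 ^ T)) X ⟩
  δ * (toℚ (2 ^ T) * X)      ≤⟨ scaleˡ-≤ 0≤δ (subst₂ _≤_ (toℚ-* (2 ^ T) (excessTotal (suc T) n)) (toℚ-* n (elenaCount n)) (toℚ-mono-≤ (excessTotal≤ T n))) ⟩
  δ * (toℚ n * toℚ (elenaCount n)) ∎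
  where
  open ≤-Reasoning
  X : ℚ
  X = toℚ (excessTotal (suc T) n)
  0≤δ : 0ℚ ≤ δ
  0≤δ = <⇒≤ 0<δ

heightTotal-upper-at : ∀ {b δ M T} → 0ℚ < δ → Margin b δ M → toℚ 40 ≤ δ * toℚ T →
  ∀ n → 2 ℕ.≤ n → 2 ℕ.* M ℕ.+ 1 ℕ.≤ n → toℚ 32 + toℚ 20 * toℚ (suc T) ≤ δ * toℚ n →
  toℚ (heightTotal n) < b * toℚ (elenaCount n ℕ.* n)
heightTotal-upper-at {b} {δ} {M} {T} 0<δ margin-bδ 40≤δT n@(suc (suc j)) _ n-many n-large =
  subst (λ q → toℚ (heightTotal n) < b * q) (sym (toℚ-* e n))
    (upper-estimate {b} {δ} {toℚ e} {toℚ u} {toℚ n} {toℚ (spineTotal n)} {toℚ (heightTotal n)}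
                    {toℚ (excessTotal (suc T) n)} {toℚ (suc T)} (toℚ-mono-≤ elenas≥1) U≤2E (toℚ-nonNeg n) (toℚ-nonNeg (suc T)) margin-n
                    (spineIdentityℚ n e u (spineTotal n) spineIdentity) H≤S (excessTotal-small 0<δ 40≤δT n) n-large)
  where
  open Invariants (invariants (suc j))
  e u : ℕ
  e = elenaCount n
  u = pathCount n
  U≤2E : toℚ u ≤ toℚ 2 * toℚ e
  U≤2E = subst (toℚ u ≤_) (toℚ-* 2 e) (toℚ-mono-≤ paths≤2elenas)
  margin-n : δ * toℚ e ≤ (toℚ 2 * toℚ u - toℚ e) - (toℚ 5 - toℚ 10 * b) * toℚ e
  margin-n = margin-bδ (toℚ e) (toℚ 2 * toℚ u - toℚ e)
    (pell-nonNeg {toℚ e} {toℚ u} (toℚ-nonNeg e) (toℚ-mono-≤ (elenaCount≤pathCount j)))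
    (pell {toℚ e} {toℚ u} (cassiniℚ e u cassini)) (toℚ-mono-≤ elenas≥1) (toℚ-mono-≤ (elenaCount-large M (suc j) n-many))
  H≤S : toℚ (heightTotal n) ≤ toℚ (spineTotal n) + toℚ (suc T) * toℚ e + toℚ (excessTotal (suc T) n)
  H≤S = subst (toℚ (heightTotal n) ≤_) bound≡ (toℚ-mono-≤ (heightTotal≤ (suc T) n))
    where
    d x : ℕ
    d = spineTotal n
    x = excessTotal (suc T) n
    bound≡ : toℚ (d ℕ.+ suc T ℕ.* e ℕ.+ x) ≡ toℚ d + toℚ (suc T) * toℚ e + toℚ x
    bound≡ = trans (toℚ-+ (d ℕ.+ suc T ℕ.* e) x)
                   (cong (_+ toℚ x) (trans (toℚ-+ d (suc T ℕ.* e)) (cong (toℚ d +_) (toℚ-* (suc T) e))))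
heightTotal-upper-at _ _ _ 0 () _ _
heightTotal-upper-at _ _ _ 1 (s≤s ()) _ _

-- Upper bound for all large n: choose the margin, then T, then n.
heightTotal-upper : ∀ b → CLt b → ∃[ N ] ∀ n → N ℕ.≤ n → 2 ℕ.≤ n →
  toℚ (heightTotal n) < b * toℚ (elenaCount n ℕ.* n)
heightTotal-upper b c<b = N₁ ℕ.+ (2 ℕ.* M ℕ.+ 1) , λ n N≤n 2≤n →
  heightTotal-upper-at {b} {δ} {M} {T} 0<δ margin-bδ 40≤δT n 2≤n (ℕ.m+n≤o⇒n≤o N₁ N≤n)
    (≤-trans N₁-large (scaleˡ-≤ (<⇒≤ 0<δ) (toℚ-mono-≤ (ℕ.m+n≤o⇒m≤o N₁ N≤n))))
  where
  δ : ℚ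
  δ = proj₁ (margin b c<b)
  0<δ : 0ℚ < δ
  0<δ = proj₁ (proj₂ (margin b c<b))
  M : ℕ
  M = proj₁ (proj₂ (proj₂ (margin b c<b)))
  margin-bδ : Margin b δ M
  margin-bδ = proj₂ (proj₂ (proj₂ (margin b c<b)))
  T : ℕ
  T = proj₁ (archimedean (toℚ 40) δ 0<δ)
  40≤δT : toℚ 40 ≤ δ * toℚ T
  40≤δT = proj₂ (archimedean (toℚ 40) δ 0<δ)
  N₁ : ℕ
  N₁ = proj₁ (archimedean (toℚ 32 + toℚ 20 * toℚ (suc T)) δ 0<δ)
  N₁-large : toℚ 32 + toℚ 20 * toℚ (suc T) ≤ δ * toℚ N₁
  N₁-large = proj₂ (archimedean (toℚ 32 + toℚ 20 * toℚ (suc T)) δ 0<δ)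

length≡elenaCount : ∀ n L → EnumeratesElenas n L → length L ≡ elenaCount n
length≡elenaCount n L enum = trans (↭-length (enumeration↭elenas n L enum)) (length≡total-1 (elenas n))

heightSum≡heightTotal : ∀ n L → EnumeratesElenas n L → sum (map height L) ≡ heightTotal n
heightSum≡heightTotal n L enum = sum-↭ (map⁺ height (enumeration↭elenas n L enum))

Bracketed : ℚ → ℚ → ℕ → ℕ → ℕ → Set
Bracketed a b n count heights =
  (a * toℚ (count ℕ.* n) < toℚ heights) × (toℚ heights < b * toℚ (count ℕ.* n))

mainTheorem8 : (L : ℕ → List Tree) → (∀ (n : ℕ) → EnumeratesElenas n (L n)) → ExpectedHeightRatioTendsToC L
mainTheorem8 L enumerates a b a<c c<b = N ℕ.+ 2 , λ n N+2≤n →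
  subst₂ (Bracketed a b n) (sym (length≡elenaCount n (L n) (enumerates n)))
                           (sym (heightSum≡heightTotal n (L n) (enumerates n)))
         (heightTotal-lower a a<c n (ℕ.m+n≤o⇒n≤o N N+2≤n) ,
          upper n (ℕ.m+n≤o⇒m≤o N N+2≤n) (ℕ.m+n≤o⇒n≤o N N+2≤n))
  where
  N : ℕ
  N = proj₁ (heightTotal-upper b c<b)
  upper : ∀ n → N ℕ.≤ n → 2 ℕ.≤ n → toℚ (heightTotal n) < b * toℚ (elenaCount n ℕ.* n)
  upper = proj₂ (heightTotal-upper b c<b)
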